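{- Let $\mathcal{R}$ be a rewrite system on a set $\mathcal{F}$ of symbols, and $t$ a term of $\mathcal{T}(\mathcal{F},\mathcal{X}\cup\mathcal{X}_A)$. If there exists a simplification ordering $\succ$ such that $l\succ r$ for all $l\rightarrow r\in\mathcal{U}(t)$, then any ground instance of $t$ is terminating (has no infinite $\mathcal{R}$-rewriting chain).
   Context: $\mathcal{F}$ is a finite signature, $\mathcal{X}$ a finite set of variables, and $\mathcal{X}_A$ a set of "abstraction variables" disjoint from $\mathcal{X}$. A ground instance $\alpha t$ is obtained by a ground substitution $\alpha$ which, by convention, maps every abstraction variable to a ground term in $\mathcal{R}$-normal form. A simplification ordering is an ordering $\succ$ on terms that is $\mathcal{F}$-stable ($t\succ t'$ implies $f(\ldots t\ldots)\succ f(\ldots t'\ldots)$), has the subterm property ($f(\ldots t\ldots)\succ t$) and is stable under substitution ($t\succ t'$ implies $\sigma t\succ\sigma t'$). For $f\in\mathcal{F}$, $Rls(f)=\{l\rightarrow r\in\mathcal{R}\mid \text{the top symbol of } l \text{ is } f\}$. The usable rules $\mathcal{U}(t)$ are defined by: $\mathcal{U}(t)=\mathcal{R}$ if $t\in\mathcal{X}$; $\mathcal{U}(t)=\emptyset$ if $t\in\mathcal{X}_A$; $\mathcal{U}(f(u_1,\ldots,u_n))=Rls(f)\cup\bigcup_{i=1}^n\mathcal{U}(u_i)\cup\bigcup_{l\rightarrow r\in Rls(f)}\mathcal{U}(r)$. -}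

module Defs where

open import Data.Nat using (ℕ; suc)
open import Data.Fin using (Fin)
open import Data.Vec using (Vec; []; _∷_; lookup; _[_]≔_)
open import Data.Sum using (_⊎_; inj₁; inj₂)
open import Data.Product using (Σ; ∃; _×_; _,_; proj₁; proj₂)
open import Data.Empty using (⊥)
open import Relation.Nullary using (¬_)
open import Relation.Binary.PropositionalEquality using (_≡_)

module _ {nF : ℕ} (ar : Fin nF → ℕ) where

  data Term (V : Set) : Set where
    var : V → Term V
    fun : (f : Fin nF) → Vec (Term V) (ar f) → Term V

  mutual
    _⟨_⟩ : {A B : Set} → Term A → (A → Term B) → Term B
    var x ⟨ σ ⟩ = σ x
    fun f ts ⟨ σ ⟩ = fun f (ts ⟨ σ ⟩*)

    _⟨_⟩* : {A B : Set} {n : ℕ} → Vec (Term A) n → (A → Term B) → Vec (Term B) n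
    [] ⟨ σ ⟩* = []
    (t ∷ ts) ⟨ σ ⟩* = (t ⟨ σ ⟩) ∷ (ts ⟨ σ ⟩*)

  data _∈V_ {A : Set} (x : A) : Term A → Set where
    here  : x ∈V var x
    there : {f : Fin nF} {ts : Vec (Term A) (ar f)} (i : Fin (ar f)) →
            x ∈V lookup ts i → x ∈V fun f ts

  HasTop : {A : Set} → Term A → Fin nF → Set
  HasTop {A} t f = Σ (Vec (Term A) (ar f)) λ ts → t ≡ fun f ts

  Rule : ℕ → Set
  Rule nX = Term (Fin nX) × Term (Fin nX)

  IsRewriteSystem : {nX : ℕ} → (Rule nX → Set) → Set
  IsRewriteSystem {nX} R =
    (l r : Term (Fin nX)) → R (l , r) →
      (∃ λ f → HasTop l f) × ((x : Fin nX) → x ∈V r → x ∈V l)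

  data Step {nX : ℕ} (R : Rule nX → Set) {V : Set} : Term V → Term V → Set where
    root : {l r : Term (Fin nX)} → R (l , r) → (σ : Fin nX → Term V) →
           Step R (l ⟨ σ ⟩) (r ⟨ σ ⟩)
    cong : (f : Fin nF) (ts : Vec (Term V) (ar f)) (i : Fin (ar f)) {u : Term V} →
           Step R (lookup ts i) u → Step R (fun f ts) (fun f (ts [ i ]≔ u))

  NormalForm : {nX : ℕ} → (Rule nX → Set) → {V : Set} → Term V → Set
  NormalForm R t = ¬ (∃ λ u → Step R t u)

  Terminating : {nX : ℕ} → (Rule nX → Set) → {V : Set} → Term V → Set
  Terminating R {V} t =
    ¬ (Σ (ℕ → Term V) λ c → (c 0 ≡ t) × ((n : ℕ) → Step R (c n) (c (suc n))))

  embed : {nX : ℕ} {XA : Set} → Term (Fin nX) → Term (Fin nX ⊎ XA)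
  embed t = t ⟨ (λ x → var (inj₁ x)) ⟩

  -- usable rules U(t), as the least set closed under the defining equations:
  -- U(x) = R for x ∈ X; U(x) = ∅ for x ∈ X_A;
  -- U(f(u1..un)) = Rls(f) ∪ ⋃ U(ui) ∪ ⋃_{l→r ∈ Rls(f)} U(r)
  data Usable {nX : ℕ} {XA : Set} (R : Rule nX → Set) :
              Term (Fin nX ⊎ XA) → Rule nX → Set where
    uvar : (x : Fin nX) {ρ : Rule nX} → R ρ → Usable R (var (inj₁ x)) ρ
    utop : {f : Fin nF} {ts : Vec (Term (Fin nX ⊎ XA)) (ar f)} {ρ : Rule nX} →
           R ρ → HasTop (proj₁ ρ) f → Usable R (fun f ts) ρ
    uarg : {f : Fin nF} {ts : Vec (Term (Fin nX ⊎ XA)) (ar f)} {ρ : Rule nX} →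
           (i : Fin (ar f)) → Usable R (lookup ts i) ρ → Usable R (fun f ts) ρ
    urhs : {f : Fin nF} {ts : Vec (Term (Fin nX ⊎ XA)) (ar f)} {ρ ρ' : Rule nX} →
           R ρ' → HasTop (proj₁ ρ') f → Usable R (embed {XA = XA} (proj₂ ρ')) ρ →
           Usable R (fun f ts) ρ

  record IsSimplificationOrdering {nX : ℕ} (_≻_ : Term (Fin nX) → Term (Fin nX) → Set) : Set where
    field
      irrefl  : (t : Term (Fin nX)) → ¬ (t ≻ t)
      trans   : {s t u : Term (Fin nX)} → s ≻ t → t ≻ u → s ≻ u
      F-stable : (f : Fin nF) (ts : Vec (Term (Fin nX)) (ar f)) (i : Fin (ar f))
                 {t t' : Term (Fin nX)} → t ≻ t' →
                 fun f (ts [ i ]≔ t) ≻ fun f (ts [ i ]≔ t')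
      subterm : (f : Fin nF) (ts : Vec (Term (Fin nX)) (ar f)) (i : Fin (ar f)) →
                fun f ts ≻ lookup ts i
      subst-stable : (σ : Fin nX → Term (Fin nX)) {t t' : Term (Fin nX)} →
                     t ≻ t' → (t ⟨ σ ⟩) ≻ (t' ⟨ σ ⟩)

  -- ground substitution in the sense of the paper: abstraction variables
  -- are mapped to R-normal forms; ground terms are T(F, ∅)
  IsGroundSubst : {nX : ℕ} {XA : Set} → (Rule nX → Set) →
                  (Fin nX ⊎ XA → Term ⊥) → Set
  IsGroundSubst {XA = XA} R α = (a : XA) → NormalForm R (α (inj₂ a))

-- Every rewrite step issued from tα uses a rule of U(t). Indeed, unless U(t) = R, each
-- term reached is of the form sα with U(s) ⊆ U(t): α(x) is a normal form for x ∈ X_A, a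
-- step inside an argument is covered by induction, and a root step with l → r ∈ Rls(f)
-- leads to rσ, which is rα when r is closed, while a variable in r forces U(t) = R. As ≻
-- orients U(t) and is closed under contexts and substitutions, a rewrite sequence from tα
-- descends along ≻.
--
-- No such descent is infinite, because a simplification ordering contains the homeomorphic
-- embedding and embedding of ground terms over the finite signature F is almost full
-- (Kruskal's theorem for bounded arity). The latter is proved constructively following
-- Higman: by induction on the almost-full witnesses of the labels of each arity, taken
-- lexicographically from the largest arity down. The trees into which a fixed tree
-- f(t₁,…,t_k) does not embed are re-encoded by relabelling: a node g(u₁,…,u_k) with
-- f ≼ g must have a child u_i into which t_i does not embed, and it becomes a node of
-- arity k − 1 carrying (g, i, u_i) in its label. This shrinks the labels at arity k and
-- changes only those at arity k − 1.

module Submission where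

open import Defs
open import Data.Nat using (ℕ)
open import Data.Fin using (Fin)
open import Data.Sum using (_⊎_)
open import Data.Product using (Σ; _×_; _,_)
open import Data.Empty using (⊥)

open import Level using (0ℓ)
open import Data.Nat using (zero; suc; _<_; _≤_; s≤s; z≤n)
import Data.Nat.Properties as ℕ
open import Data.Fin using (zero; suc; punchIn; punchOut)
import Data.Fin.Properties as Finₚ
open import Data.Fin.Properties using (any?; all?; ¬∀⟶∃¬)
open import Data.Vec using (Vec; []; _∷_; lookup; _[_]≔_; tabulate)
open import Data.Vec.Properties using (lookup∘tabulate; []≔-lookup; lookup∘update; lookup∘update′)
import Data.List as List
open import Data.List.Extrema.Nat using (max; xs≤max)
import Data.List.Relation.Unary.All as All
open import Data.List.Membership.Propositional.Properties using (∈-tabulate⁺)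
open import Data.Sum using (inj₁; inj₂)
import Data.Sum as Sum
open import Data.Sum.Relation.Binary.Pointwise using (inj₁; inj₂; ⊎-decidable) renaming (Pointwise to _⊎ᵣ_)
open import Data.Product using (∃; ∃₂; proj₁; proj₂; -,_)
import Data.Product as Product
open import Data.Product.Relation.Binary.Pointwise.NonDependent using (Pointwise; ×-decidable)
open import Data.Empty using (⊥-elim)
open import Data.Unit using (tt)
open import Function using (_∘_; id)
open import Induction.WellFounded using (WellFounded; Acc; acc)
import Induction.WellFounded as WF
open import Relation.Nullary using (¬_; yes; no; contradiction)
open import Relation.Unary using (Pred; _⊆_; _∪_; _∩_; ∁; ∅; U; ⋃; _⟨×⟩_; _⟨⊎⟩_)
open import Relation.Binary using (Rel; Decidable; Reflexive)
open import Relation.Binary.Construct.Closure.Reflexive using (ReflClosure; refl; [_])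
import Relation.Binary.Construct.Closure.Reflexive.Properties as Refl
open import Relation.Binary.PropositionalEquality as ≡ using (_≡_; _≢_; refl; sym; trans; subst; subst₂)

private
  variable
    X Y : Set
    P Q C : Pred X 0ℓ

-- Almost-full relations

-- The inductive ("bar") form of: every sequence in P has i < j with x_i ≼ x_j (see af⇒¬bad).
data AlmostFull {X : Set} (_≼_ : Rel X 0ℓ) (P : Pred X 0ℓ) : Set where
  next : (∀ {a} → P a → AlmostFull _≼_ (P ∩ ∁ (a ≼_))) → AlmostFull _≼_ P

module _ {_≼_ : Rel X 0ℓ} where

  af-inverse : AlmostFull _≼_ P → ∀ {a} → P a → AlmostFull _≼_ (P ∩ ∁ (a ≼_))
  af-inverse (next h) = h

  af-⊆ : P ⊆ Q → AlmostFull _≼_ Q → AlmostFull _≼_ P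
  af-⊆ P⊆Q (next h) = next λ pa → af-⊆ (Product.map₁ P⊆Q) (h (P⊆Q pa))

  af-∅ : AlmostFull _≼_ ∅
  af-∅ = next λ ()

  -- Stated for subsets C of P ∪ Q so that the recursion is lexicographic in the two witnesses.
  af-⊆∪ : AlmostFull _≼_ P → AlmostFull _≼_ Q → C ⊆ P ∪ Q → AlmostFull _≼_ C
  af-⊆∪ {P = P} {Q = Q} {C = C} afP@(next hP) afQ@(next hQ) C⊆P∪Q = next λ ca → step (C⊆P∪Q ca)
    where
    step : ∀ {a} → (P ∪ Q) a → AlmostFull _≼_ (C ∩ ∁ (a ≼_))
    step (inj₁ pa) = af-⊆∪ (hP pa) afQ λ (cx , a⋠x) → Sum.map₁ (_, a⋠x) (C⊆P∪Q cx)
    step (inj₂ qa) = af-⊆∪ afP (hQ qa) λ (cx , a⋠x) → Sum.map₂ (_, a⋠x) (C⊆P∪Q cx)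

  af-∪ : AlmostFull _≼_ P → AlmostFull _≼_ Q → AlmostFull _≼_ (P ∪ Q)
  af-∪ afP afQ = af-⊆∪ afP afQ id

  af-⋃ : ∀ {n} {P : Fin n → Pred X 0ℓ} → (∀ i → AlmostFull _≼_ (P i)) →
         AlmostFull _≼_ (⋃[ i ∶ Fin n ] P i)
  af-⋃ {zero} _ = af-⊆ (λ { (() , _) }) af-∅
  af-⋃ {suc n} af = af-⊆ (λ { (zero , p) → inj₁ p ; (suc i , p) → inj₂ (i , p) })
                          (af-∪ (af zero) (af-⋃ (af ∘ suc)))

  af-singleton : Reflexive _≼_ → ∀ {x} → AlmostFull _≼_ (_≡ x)
  af-singleton ≼-refl = next λ { refl → af-⊆ (λ { (refl , x⋠x) → x⋠x ≼-refl }) af-∅ }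

  af⇒¬bad : AlmostFull _≼_ P → (f : ℕ → X) → (∀ n → P (f n)) → ¬ (∀ {i j} → i < j → ¬ f i ≼ f j)
  af⇒¬bad (next h) f pf bad =
    af⇒¬bad (h (pf 0)) (f ∘ suc) (λ n → pf (suc n) , bad (s≤s z≤n)) (λ i<j → bad (s≤s i<j))

af-comap : {_≼_ : Rel X 0ℓ} {_⊑_ : Rel Y 0ℓ} (f : ∀ {x} → P x → Y) → (∀ {x} (px : P x) → Q (f px)) →
           (∀ {x y} (px : P x) (py : P y) → f px ⊑ f py → x ≼ y) → AlmostFull _⊑_ Q → AlmostFull _≼_ P
af-comap f f∈Q reflects (next h) = next λ pa →
  af-comap (f ∘ proj₁) (λ (px , a⋠x) → f∈Q px , a⋠x ∘ reflects pa px)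
           (λ px py → reflects (proj₁ px) (proj₁ py)) (h (f∈Q pa))

af-Fin : ∀ {n} → AlmostFull {Fin n} _≡_ U
af-Fin = af-⊆ (λ {i} _ → i , refl) (af-⋃ λ _ → af-singleton refl)

af-× : {_≼_ : Rel X 0ℓ} {_⊑_ : Rel Y 0ℓ} {Q : Pred Y 0ℓ} → Decidable _≼_ →
       AlmostFull _≼_ P → AlmostFull _⊑_ Q → AlmostFull (Pointwise _≼_ _⊑_) (P ⟨×⟩ Q)
af-× {P = P} {_≼_ = _≼_} {_⊑_} {Q} _≼?_ afP@(next hP) afQ@(next hQ) = next λ {(a , b)} (pa , qb) →
  af-⊆ (split a b) (af-∪ (af-× _≼?_ (hP pa) afQ) (af-× _≼?_ afP (hQ qb)))
  where
  split : ∀ a b → (P ⟨×⟩ Q) ∩ ∁ (Pointwise _≼_ _⊑_ (a , b)) ⊆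
                  ((P ∩ ∁ (a ≼_)) ⟨×⟩ Q) ∪ (P ⟨×⟩ (Q ∩ ∁ (b ⊑_)))
  split a b {x , y} ((px , qy) , ab⋠xy) with a ≼? x
  ... | yes a≼x = inj₂ (px , qy , λ b⊑y → ab⋠xy (a≼x , b⊑y))
  ... | no a⋠x = inj₁ ((px , a⋠x) , qy)

af-⊎ : {_≼_ : Rel X 0ℓ} {_⊑_ : Rel Y 0ℓ} {Q : Pred Y 0ℓ} →
       AlmostFull _≼_ P → AlmostFull _⊑_ Q → AlmostFull (_≼_ ⊎ᵣ _⊑_) (P ⟨⊎⟩ Q)
af-⊎ {P = P} {_≼_ = _≼_} {_⊑_} {Q} afP@(next hP) afQ@(next hQ) = next λ {c} → step c
  where
  step : ∀ c → (P ⟨⊎⟩ Q) c → AlmostFull (_≼_ ⊎ᵣ _⊑_) ((P ⟨⊎⟩ Q) ∩ ∁ ((_≼_ ⊎ᵣ _⊑_) c))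
  step (inj₁ _) pa = af-⊆ (λ { {inj₁ _} (px , a⋠x) → px , a⋠x ∘ inj₁ ; {inj₂ _} (qy , _) → qy })
                          (af-⊎ (hP pa) afQ)
  step (inj₂ _) qb = af-⊆ (λ { {inj₁ _} (px , _) → px ; {inj₂ _} (qy , b⋠y) → qy , b⋠y ∘ inj₂ })
                          (af-⊎ afP (hQ qb))

-- Label systems

record Labels : Set₁ where
  constructor labels
  field
    Label      : Set
    _≼_        : Rel Label 0ℓ
    _≼?_       : Decidable _≼_
    Allowed    : Pred Label 0ℓ
    almostFull : AlmostFull _≼_ Allowed

open Labels using (Label; Allowed)

shrink : (L : Labels) {a : Label L} → Allowed L a → Labels
shrink L {a} pa = record L
  { Allowed = Allowed L ∩ ∁ (Labels._≼_ L a) ; almostFull = af-inverse (Labels.almostFull L) pa }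

shrink-≡ : ∀ {X _≼_ _≼?_ P af} {L : Labels} → L ≡ labels X _≼_ _≼?_ P af → ∀ {a} (pa : Allowed L a) →
           ∃ λ b → Σ (P b) λ pb → shrink L pa ≡ labels X _≼_ _≼?_ (P ∩ ∁ (b ≼_)) (af-inverse af pb)
shrink-≡ refl pa = -, pa , refl

_⊎ᴸ_ : Labels → Labels → Labels
L ⊎ᴸ M = labels (Label L ⊎ Label M) (L._≼_ ⊎ᵣ M._≼_) (⊎-decidable L._≼?_ M._≼?_)
                (Allowed L ⟨⊎⟩ Allowed M) (af-⊎ L.almostFull M.almostFull)
  where
  module L = Labels L
  module M = Labels M

relabel : {L M : Labels} → L ≡ M → Σ (Label M) (Allowed M) → Σ (Label L) (Allowed L)
relabel refl = id

relabel-≼ : {L M : Labels} (e e′ : L ≡ M) (x y : Σ (Label M) (Allowed M)) →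
            Labels._≼_ L (proj₁ (relabel e x)) (proj₁ (relabel e′ y)) → Labels._≼_ M (proj₁ x) (proj₁ y)
relabel-≼ refl refl _ _ = id

Empty : Labels → Set
Empty L = ∀ b → ¬ Allowed L b

-- The labels of the nodes of arity j are drawn from the j-th component.
LabelSystem : Set₁
LabelSystem = ℕ → Labels

EmptyFrom : ℕ → LabelSystem → Set
EmptyFrom K S = ∀ {j} → K ≤ j → Empty (S j)

-- Lexicographic order on the almost-full witnesses of the components K − 1, …, 0.
_⊏⟨_⟩_ : LabelSystem → ℕ → LabelSystem → Set₁
S′ ⊏⟨ K ⟩ S = ∃ λ k → k < K × (∃ λ a → Σ (Allowed (S k) a) λ pa → S′ k ≡ shrink (S k) pa)
                            × (∀ {j} → k < j → S′ j ≡ S j)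

⊏-EmptyFrom : ∀ {K S′ S} → S′ ⊏⟨ K ⟩ S → EmptyFrom K S → EmptyFrom K S′
⊏-EmptyFrom (_ , k<K , _ , above) empty K≤j = subst Empty (sym (above (ℕ.<-≤-trans k<K K≤j))) (empty K≤j)

⊏-wellFounded : ∀ K → WellFounded (_⊏⟨ K ⟩_)
⊏-wellFounded zero S = acc λ { (_ , () , _) }
-- Induction on the witness of component K and, inside it, on ⊏⟨ K ⟩, which fixes component K.
⊏-wellFounded (suc K) S = accessible (Labels.almostFull (S K)) refl (⊏-wellFounded K S)
  where
  accessible : ∀ {X _≼_ _≼?_ P} (af : AlmostFull _≼_ P) {S} → S K ≡ labels X _≼_ _≼?_ P af →
               Acc (_⊏⟨ K ⟩_) S → Acc (_⊏⟨ suc K ⟩_) S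
  below : ∀ {X _≼_ _≼?_ P} (af : AlmostFull _≼_ P) {S} → S K ≡ labels X _≼_ _≼?_ P af →
          Acc (_⊏⟨ K ⟩_) S → ∀ {S′} → S′ ⊏⟨ suc K ⟩ S → Acc (_⊏⟨ suc K ⟩_) S′
  accessible af SK≡ accK = acc (below af SK≡ accK)
  below af SK≡ (acc rs) (k , k<1+K , shrunk , above) with ℕ.m<1+n⇒m<n∨m≡n k<1+K
  ... | inj₁ k<K = accessible af (trans (above k<K) SK≡) (rs (k , k<K , shrunk , above))
  below (next h) SK≡ _ {S′} (_ , _ , (_ , pa , S′K≡) , _) | inj₂ refl with shrink-≡ SK≡ pa
  ... | _ , pb , shrunk≡ = accessible (h pb) (trans S′K≡ shrunk≡) (⊏-wellFounded K S′)

-- Kruskal's theorem for bounded arity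

module Trees (S : LabelSystem) where

  data Tree : Set where
    node : (j : ℕ) (b : Label (S j)) → Allowed (S j) b → (Fin j → Tree) → Tree

  infix 4 _⊴_ _⊴?_

  data _⊴_ : Tree → Tree → Set where
    dive : ∀ {u j b q vs} (i : Fin j) → u ⊴ vs i → u ⊴ node j b q vs
    both : ∀ {j b b′ q q′ us vs} → Labels._≼_ (S j) b b′ → (∀ i → us i ⊴ vs i) →
           node j b q us ⊴ node j b′ q′ vs

  _⊴?_ : Decidable _⊴_
  u@(node j b q us) ⊴? node j′ b′ q′ vs with any? (λ i → u ⊴? vs i)
  ... | yes (i , u⊴vsᵢ) = yes (dive i u⊴vsᵢ)
  ... | no ¬dive with j ℕ.≟ j′
  ...   | no j≢j′ = no λ { (dive i p) → ¬dive (i , p) ; (both _ _) → j≢j′ refl }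
  ...   | yes refl with Labels._≼?_ (S j) b b′ | all? (λ i → us i ⊴? vs i)
  ...     | yes b≼b′ | yes us⊴vs = yes (both b≼b′ us⊴vs)
  ...     | no b⋠b′ | _ = no λ { (dive i p) → ¬dive (i , p) ; (both b≼b′ _) → b⋠b′ b≼b′ }
  ...     | _ | no ¬us⊴vs = no λ { (dive i p) → ¬dive (i , p) ; (both _ us⊴vs) → ¬us⊴vs us⊴vs }

Fin⇒≡suc : ∀ {k} → Fin k → ∃ λ m → suc m ≡ k
Fin⇒≡suc {suc m} _ = m , refl

-- Indexed by suc m ≡ k rather than by Fin (suc m): in Lift, k is a module parameter and
-- cannot be refined by pattern matching.
skip : ∀ {m k} → suc m ≡ k → Fin k → Fin m → Fin k
skip refl = punchIn

skip-cover : ∀ {m k} (e : suc m ≡ k) (i : Fin k) {P : Pred (Fin k) 0ℓ} →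
             P i → (∀ c → P (skip e i c)) → ∀ j → P j
skip-cover refl i {P} Pi Pskip j with i Finₚ.≟ j
... | yes refl = Pi
... | no i≢j = subst P (Finₚ.punchIn-punchOut i≢j) (Pskip (punchOut i≢j))

module Lift (S : LabelSystem) {k : ℕ} {a : Label (S k)} (pa : Allowed (S k) a) (ts : Fin k → Trees.Tree S)
            (af-ts : ∀ i → AlmostFull (Trees._⊴_ S) (∁ (Trees._⊴_ S (ts i)))) where

  open Trees S
  open Labels (S k) using () renaming (_≼_ to _≼ₖ_; _≼?_ to _≼ₖ?_)

  t : Tree
  t = node k a pa ts

  -- (b, i, u) labels the node of arity k − 1 that replaces a node labelled b ≽ a whose i-th
  -- child u does not embed ts i; that child is dropped (see skip).
  Mark : Labels
  Mark = labels (Label (S k) × Fin k × Tree) (Pointwise _≼ₖ_ (Pointwise _≡_ _⊴_))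
                (×-decidable _≼ₖ?_ (×-decidable Finₚ._≟_ _⊴?_))
                (λ (b , i , u) → Allowed (S k) b × ¬ ts i ⊴ u)
                (af-⊆ (λ {(_ , i , _)} (pb , tsᵢ⋬u) → i , pb , refl , tsᵢ⋬u)
                      (af-⋃ λ i → af-× _≼ₖ?_ (Labels.almostFull (S k))
                                             (af-× Finₚ._≟_ (af-singleton refl) (af-ts i))))

  S′ : LabelSystem
  S′ j with j ℕ.≟ k | suc j ℕ.≟ k
  ... | yes _ | _ = shrink (S k) pa
  ... | no _ | yes _ = S j ⊎ᴸ Mark
  ... | no _ | no _ = S j

  S′-k : S′ k ≡ shrink (S k) pa
  S′-k with k ℕ.≟ k | suc k ℕ.≟ k
  ... | yes _ | _ = refl
  ... | no k≢k | _ = contradiction refl k≢k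

  S′-marked : ∀ {m} → suc m ≡ k → S′ m ≡ S m ⊎ᴸ Mark
  S′-marked {m} refl with m ℕ.≟ suc m | suc m ℕ.≟ suc m
  ... | yes m≡1+m | _ = contradiction (sym m≡1+m) ℕ.1+n≢n
  ... | no _ | yes _ = refl
  ... | no _ | no 1+m≢1+m = contradiction refl 1+m≢1+m

  S′-other : ∀ {j} → j ≢ k → suc j ≢ k → S′ j ≡ S j
  S′-other {j} j≢k 1+j≢k with j ℕ.≟ k | suc j ℕ.≟ k
  ... | yes j≡k | _ = contradiction j≡k j≢k
  ... | no _ | yes 1+j≡k = contradiction 1+j≡k 1+j≢k
  ... | no _ | no _ = refl

  S′⊏S : ∀ {K} → k < K → S′ ⊏⟨ K ⟩ S
  S′⊏S k<K = k , k<K , (a , pa , S′-k) , λ k<j → S′-other (ℕ.>⇒≢ k<j) (ℕ.>⇒≢ (ℕ.m<n⇒m<1+n k<j))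

  module T′ = Trees S′

  node-via : ∀ {j L} → S′ j ≡ L → Σ (Label L) (Allowed L) → (Fin j → T′.Tree) → T′.Tree
  node-via {j} e bq = T′.node j (proj₁ (relabel e bq)) (proj₂ (relabel e bq))

  infix 4 _↦_

  data _↦_ : Tree → T′.Tree → Set₁ where
    keep   : ∀ {j b q us xs} (e : S′ j ≡ S j) → j ≢ k → suc j ≢ k →
             (∀ i → us i ↦ xs i) → node j b q us ↦ node-via e (b , q) xs
    lower  : ∀ {j b q us xs} (e : S′ j ≡ S j ⊎ᴸ Mark) → suc j ≡ k →
             (∀ i → us i ↦ xs i) → node j b q us ↦ node-via e (inj₁ b , q) xs
    shrunk : ∀ {b q us xs} (e : S′ k ≡ shrink (S k) pa) (a⋠b : ¬ a ≼ₖ b) →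
             (∀ i → us i ↦ xs i) → node k b q us ↦ node-via e (b , q , a⋠b) xs
    marked : ∀ {m b q us xs} (e : S′ m ≡ S m ⊎ᴸ Mark) (1+m≡k : suc m ≡ k)
               (i : Fin k) (tsᵢ⋬usᵢ : ¬ ts i ⊴ us i) →
             (∀ c → us (skip 1+m≡k i c) ↦ xs c) →
             node k b q us ↦ node-via e (inj₂ (b , i , us i) , q , tsᵢ⋬usᵢ) xs

  translate-node : ∀ j b q (us : Fin j → Tree) → (∀ i → ∃ (us i ↦_)) →
                   ¬ t ⊴ node j b q us → ∃ (node j b q us ↦_)
  translate-node j b q us children t⋬u with j ℕ.≟ k | suc j ℕ.≟ k
  ... | no j≢k | no 1+j≢k = -, keep (S′-other j≢k 1+j≢k) j≢k 1+j≢k (proj₂ ∘ children)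
  ... | no _ | yes 1+j≡k = -, lower (S′-marked 1+j≡k) 1+j≡k (proj₂ ∘ children)
  ... | yes refl | _ with a ≼ₖ? b
  ...   | no a⋠b = -, shrunk S′-k a⋠b (proj₂ ∘ children)
  ...   | yes a≼b with all? (λ i → ts i ⊴? us i)
  ...     | yes ts⊴us = contradiction (both a≼b ts⊴us) t⋬u
  ...     | no ts⋬us with ¬∀⟶∃¬ k _ (λ i → ts i ⊴? us i) ts⋬us
  ...       | i , tsᵢ⋬usᵢ with Fin⇒≡suc i
  ...         | _ , 1+m≡k =
    -, marked (S′-marked 1+m≡k) 1+m≡k i tsᵢ⋬usᵢ (λ c → proj₂ (children (skip 1+m≡k i c)))

  translate : ∀ u → ¬ t ⊴ u → ∃ (u ↦_)
  translate (node j b q us) t⋬u = translate-node j b q us (λ i → translate (us i) (t⋬u ∘ dive i)) t⋬u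

  reflect : ∀ {u v x y} → u ↦ x → v ↦ y → x T′.⊴ y → u ⊴ v
  reflect u↦x (keep _ _ _ vs↦) (T′.dive c x⊴) = dive c (reflect u↦x (vs↦ c) x⊴)
  reflect u↦x (lower _ _ vs↦) (T′.dive c x⊴) = dive c (reflect u↦x (vs↦ c) x⊴)
  reflect u↦x (shrunk _ _ vs↦) (T′.dive c x⊴) = dive c (reflect u↦x (vs↦ c) x⊴)
  reflect u↦x (marked _ 1+m≡k i _ vs↦) (T′.dive c x⊴) = dive (skip 1+m≡k i c) (reflect u↦x (vs↦ c) x⊴)
  reflect (keep {b = b} {q} e _ _ us↦) (keep {b = b′} {q′} e′ _ _ vs↦) (T′.both b≼b′ xs⊴ys) =
    both (relabel-≼ e e′ (b , q) (b′ , q′) b≼b′) λ i → reflect (us↦ i) (vs↦ i) (xs⊴ys i)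
  reflect (keep _ _ 1+j≢k _) (lower _ 1+j≡k _) (T′.both _ _) = contradiction 1+j≡k 1+j≢k
  reflect (keep _ j≢k _ _) (shrunk _ _ _) (T′.both _ _) = contradiction refl j≢k
  reflect (keep _ _ 1+j≢k _) (marked _ 1+j≡k _ _ _) (T′.both _ _) = contradiction 1+j≡k 1+j≢k
  reflect (lower _ 1+j≡k _) (keep _ _ 1+j≢k _) (T′.both _ _) = contradiction 1+j≡k 1+j≢k
  reflect (lower {b = b} {q} e _ us↦) (lower {b = b′} {q′} e′ _ vs↦) (T′.both b≼b′ xs⊴ys)
    with relabel-≼ e e′ (inj₁ b , q) (inj₁ b′ , q′) b≼b′
  ... | inj₁ b≼b′ = both b≼b′ λ i → reflect (us↦ i) (vs↦ i) (xs⊴ys i)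
  reflect (lower _ 1+k≡k _) (shrunk _ _ _) (T′.both _ _) = contradiction 1+k≡k ℕ.1+n≢n
  reflect (lower {b = b} {q} e _ _) (marked {b = b′} {q′} {vs} e′ _ i′ tsᵢ′⋬vsᵢ′ _) (T′.both b≼b′ _)
    with relabel-≼ e e′ (inj₁ b , q) (inj₂ (b′ , i′ , vs i′) , q′ , tsᵢ′⋬vsᵢ′) b≼b′
  ... | ()
  reflect (shrunk _ _ _) (keep _ k≢k _ _) (T′.both _ _) = contradiction refl k≢k
  reflect (shrunk _ _ _) (lower _ 1+k≡k _) (T′.both _ _) = contradiction 1+k≡k ℕ.1+n≢n
  reflect (shrunk {b = b} {q} e a⋠b us↦) (shrunk {b = b′} {q′} e′ a⋠b′ vs↦) (T′.both b≼b′ xs⊴ys) =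
    both (relabel-≼ e e′ (b , q , a⋠b) (b′ , q′ , a⋠b′) b≼b′) λ i → reflect (us↦ i) (vs↦ i) (xs⊴ys i)
  reflect (shrunk _ _ _) (marked _ 1+k≡k _ _ _) (T′.both _ _) = contradiction 1+k≡k ℕ.1+n≢n
  reflect (marked _ 1+j≡k _ _ _) (keep _ _ 1+j≢k _) (T′.both _ _) = contradiction 1+j≡k 1+j≢k
  reflect (marked {b = b} {q} {us} e _ i tsᵢ⋬usᵢ _) (lower {b = b′} {q′} e′ _ _) (T′.both b≼b′ _)
    with relabel-≼ e e′ (inj₂ (b , i , us i) , q , tsᵢ⋬usᵢ) (inj₁ b′ , q′) b≼b′
  ... | ()
  reflect (marked _ 1+k≡k _ _ _) (shrunk _ _ _) (T′.both _ _) = contradiction 1+k≡k ℕ.1+n≢n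
  reflect (marked {b = b} {q} {us} e 1+m≡k i tsᵢ⋬usᵢ us↦)
          (marked {b = b′} {q′} {vs} e′ 1+m≡k′ i′ tsᵢ′⋬vsᵢ′ vs↦) (T′.both b≼b′ xs⊴ys)
    with relabel-≼ e e′ (inj₂ (b , i , us i) , q , tsᵢ⋬usᵢ) (inj₂ (b′ , i′ , vs i′) , q′ , tsᵢ′⋬vsᵢ′)
                   b≼b′
       | ℕ.≡-irrelevant 1+m≡k 1+m≡k′
  ... | inj₂ (b≼b′ , refl , usᵢ⊴vsᵢ) | refl =
    both b≼b′ (skip-cover 1+m≡k i usᵢ⊴vsᵢ λ c → reflect (us↦ c) (vs↦ c) (xs⊴ys c))

  af-∁⊴-via-S′ : AlmostFull T′._⊴_ U → AlmostFull _⊴_ (∁ (t ⊴_))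
  af-∁⊴-via-S′ = af-comap (λ {u} t⋬u → proj₁ (translate u t⋬u)) (λ _ → tt)
                          (λ {u} {v} t⋬u t⋬v → reflect (proj₂ (translate u t⋬u)) (proj₂ (translate v t⋬v)))

⊴-almostFull : ∀ K (S : LabelSystem) → EmptyFrom K S → AlmostFull (Trees._⊴_ S) U
⊴-almostFull K = WF.All.wfRec (⊏-wellFounded K) 0ℓ (λ S → EmptyFrom K S → AlmostFull (Trees._⊴_ S) U) step
  where
  step : ∀ S → (∀ {S′} → S′ ⊏⟨ K ⟩ S → EmptyFrom K S′ → AlmostFull (Trees._⊴_ S′) U) →
         EmptyFrom K S → AlmostFull (Trees._⊴_ S) U
  step S ih empty = next λ {t} _ → af-⊆ proj₂ (af-∁⊴ t)
    where
    open Trees S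
    af-∁⊴ : ∀ t → AlmostFull _⊴_ (∁ (t ⊴_))
    af-∁⊴ (node k a pa ts) with K ℕ.≤? k
    ... | yes K≤k = contradiction pa (empty K≤k a)
    ... | no K≰k = L.af-∁⊴-via-S′ (ih S′⊏S (⊏-EmptyFrom S′⊏S empty))
      where
      af-children : ∀ i → AlmostFull _⊴_ (∁ (ts i ⊴_))
      af-children i = af-∁⊴ (ts i)
      module L = Lift S pa ts af-children
      S′⊏S = L.S′⊏S (ℕ.≰⇒> K≰k)

-- Terms

module Terms {nF : ℕ} (ar : Fin nF → ℕ) where

  infixl 8 _⟪_⟫ _⟪_⟫*

  _⟪_⟫ : {A B : Set} → Term ar A → (A → Term ar B) → Term ar B
  _⟪_⟫ = _⟨_⟩ ar

  _⟪_⟫* : {A B : Set} {n : ℕ} → Vec (Term ar A) n → (A → Term ar B) → Vec (Term ar B) n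
  _⟪_⟫* = _⟨_⟩* ar

  lookup-⟪⟫* : ∀ {A B n} (ts : Vec (Term ar A) n) (σ : A → Term ar B) i →
               lookup (ts ⟪ σ ⟫*) i ≡ lookup ts i ⟪ σ ⟫
  lookup-⟪⟫* (t ∷ ts) σ zero = refl
  lookup-⟪⟫* (t ∷ ts) σ (suc i) = lookup-⟪⟫* ts σ i

  []≔-⟪⟫* : ∀ {A B n} (ts : Vec (Term ar A) n) (σ : A → Term ar B) i u →
            (ts [ i ]≔ u) ⟪ σ ⟫* ≡ ts ⟪ σ ⟫* [ i ]≔ u ⟪ σ ⟫
  []≔-⟪⟫* (t ∷ ts) σ zero u = refl
  []≔-⟪⟫* (t ∷ ts) σ (suc i) u = ≡.cong (t ⟪ σ ⟫ ∷_) ([]≔-⟪⟫* ts σ i u)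

  ⟪⟫-∘ : ∀ {A B C} (t : Term ar A) (σ : A → Term ar B) (τ : B → Term ar C) →
         t ⟪ σ ⟫ ⟪ τ ⟫ ≡ t ⟪ (λ x → σ x ⟪ τ ⟫) ⟫
  ⟪⟫*-∘ : ∀ {A B C n} (ts : Vec (Term ar A) n) (σ : A → Term ar B) (τ : B → Term ar C) →
          ts ⟪ σ ⟫* ⟪ τ ⟫* ≡ ts ⟪ (λ x → σ x ⟪ τ ⟫) ⟫*
  ⟪⟫-∘ (var x) σ τ = refl
  ⟪⟫-∘ (fun f ts) σ τ = ≡.cong (fun f) (⟪⟫*-∘ ts σ τ)
  ⟪⟫*-∘ [] σ τ = refl
  ⟪⟫*-∘ (t ∷ ts) σ τ = ≡.cong₂ _∷_ (⟪⟫-∘ t σ τ) (⟪⟫*-∘ ts σ τ)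

  var-or-closed : ∀ {A} (t : Term ar A) →
                  (∃ λ x → _∈V_ ar x t) ⊎ (∀ {B} (σ τ : A → Term ar B) → t ⟪ σ ⟫ ≡ t ⟪ τ ⟫)
  var-or-closed* : ∀ {A n} (ts : Vec (Term ar A) n) →
                   (∃₂ λ i x → _∈V_ ar x (lookup ts i)) ⊎
                   (∀ {B} (σ τ : A → Term ar B) → ts ⟪ σ ⟫* ≡ ts ⟪ τ ⟫*)
  var-or-closed (var x) = inj₁ (x , here)
  var-or-closed (fun f ts) with var-or-closed* ts
  ... | inj₁ (i , x , x∈tsᵢ) = inj₁ (x , there i x∈tsᵢ)
  ... | inj₂ closed = inj₂ λ σ τ → ≡.cong (fun f) (closed σ τ)
  var-or-closed* [] = inj₂ λ _ _ → refl
  var-or-closed* (t ∷ ts) with var-or-closed t | var-or-closed* ts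
  ... | inj₁ (x , x∈t) | _ = inj₁ (zero , x , x∈t)
  ... | inj₂ _ | inj₁ (i , x , x∈tsᵢ) = inj₁ (suc i , x , x∈tsᵢ)
  ... | inj₂ t-closed | inj₂ ts-closed = inj₂ λ σ τ → ≡.cong₂ _∷_ (t-closed σ τ) (ts-closed σ τ)

  Step-map : ∀ {nX V} {Rs Rs′ : Rule ar nX → Set} → Rs ⊆ Rs′ →
             {u u′ : Term ar V} → Step ar Rs u u′ → Step ar Rs′ u u′
  Step-map Rs⊆Rs′ (root ρ σ) = root (Rs⊆Rs′ ρ) σ
  Step-map Rs⊆Rs′ (cong f us i st) = cong f us i (Step-map Rs⊆Rs′ st)

  Symbols : LabelSystem
  Symbols j = labels (Fin nF) _≡_ Finₚ._≟_ (λ f → ar f ≡ j) (af-⊆ _ af-Fin)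

  maxArity : ℕ
  maxArity = max 0 (List.tabulate ar)

  ar≤maxArity : ∀ f → ar f ≤ maxArity
  ar≤maxArity f = All.lookup (xs≤max 0 (List.tabulate ar)) (∈-tabulate⁺ f)

  Symbols-EmptyFrom : EmptyFrom (suc maxArity) Symbols
  Symbols-EmptyFrom 1+max≤j f refl = ℕ.<⇒≱ (s≤s (ar≤maxArity f)) 1+max≤j

  open Trees Symbols

  toTree : Term ar ⊥ → Tree
  toTrees : ∀ {n} → Vec (Term ar ⊥) n → Fin n → Tree
  toTree (fun f ts) = node (ar f) f refl (toTrees ts)
  toTrees (t ∷ ts) zero = toTree t
  toTrees (t ∷ ts) (suc i) = toTrees ts i

  module Ordered {nX : ℕ} {_≻_ : Rel (Term ar (Fin nX)) 0ℓ} (isSO : IsSimplificationOrdering ar _≻_) where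

    open IsSimplificationOrdering isSO renaming (trans to ≻-trans)

    _≽_ : Rel (Term ar (Fin nX)) 0ℓ
    _≽_ = ReflClosure _≻_

    ≻⇒⋡ : ∀ {x y} → x ≻ y → ¬ y ≽ x
    ≻⇒⋡ {x} x≻y refl = irrefl x x≻y
    ≻⇒⋡ {x} x≻y [ y≻x ] = irrefl x (≻-trans x≻y y≻x)

    descending : ∀ (c : ℕ → Term ar (Fin nX)) → (∀ n → c n ≻ c (suc n)) → ∀ {i j} → i < j → c i ≻ c j
    descending c step {i} {suc j} i<1+j with ℕ.m<1+n⇒m<n∨m≡n i<1+j
    ... | inj₁ i<j = ≻-trans (descending c step i<j) (step j)
    ... | inj₂ refl = step i

    ≽-context : ∀ {n} (C : Vec (Term ar (Fin nX)) n → Term ar (Fin nX)) →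
                (∀ zs i {x y} → x ≻ y → C (zs [ i ]≔ x) ≻ C (zs [ i ]≔ y)) →
                ∀ {xs ys} → (∀ i → lookup xs i ≽ lookup ys i) → C xs ≽ C ys
    ≽-context C mono {[]} {[]} _ = refl
    ≽-context C mono {x ∷ xs} {y ∷ ys} xs≽ys =
      Refl.trans ≻-trans (head-≽ (xs≽ys zero))
                 (≽-context (C ∘ (y ∷_)) (λ zs i → mono (y ∷ zs) (suc i)) (xs≽ys ∘ suc))
      where
      head-≽ : x ≽ y → C (x ∷ xs) ≽ C (y ∷ xs)
      head-≽ refl = refl
      head-≽ [ x≻y ] = [ mono (y ∷ xs) zero x≻y ]

    ι : Term ar ⊥ → Term ar (Fin nX)
    ι u = u ⟪ ⊥-elim ⟫

    ⟦_⟧ : Tree → Term ar (Fin nX)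
    ⟦ node _ f refl cs ⟧ = fun f (tabulate λ i → ⟦ cs i ⟧)

    ⟦toTree⟧ : ∀ u → ⟦ toTree u ⟧ ≡ ι u
    ⟦toTrees⟧ : ∀ {n} (us : Vec (Term ar ⊥) n) → tabulate (λ i → ⟦ toTrees us i ⟧) ≡ us ⟪ ⊥-elim ⟫*
    ⟦toTree⟧ (fun f us) = ≡.cong (fun f) (⟦toTrees⟧ us)
    ⟦toTrees⟧ [] = refl
    ⟦toTrees⟧ (u ∷ us) = ≡.cong₂ _∷_ (⟦toTree⟧ u) (⟦toTrees⟧ us)

    ⊴⇒≽ : ∀ {x y} → x ⊴ y → ⟦ y ⟧ ≽ ⟦ x ⟧
    ⊴⇒≽ (dive {b = f} {q = refl} {vs} i x⊴vsᵢ) =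
      Refl.trans ≻-trans [ subst (fun f ts ≻_) (lookup∘tabulate _ i) (subterm f ts i) ] (⊴⇒≽ x⊴vsᵢ)
      where ts = tabulate λ i → ⟦ vs i ⟧
    ⊴⇒≽ (both {q = refl} {refl} refl us⊴vs) =
      ≽-context (fun _) (F-stable _) λ i →
        subst₂ _≽_ (sym (lookup∘tabulate _ i)) (sym (lookup∘tabulate _ i)) (⊴⇒≽ (us⊴vs i))

    ground-no-descending-chain : (c : ℕ → Term ar ⊥) → ¬ (∀ n → ι (c n) ≻ ι (c (suc n)))
    ground-no-descending-chain c step = af⇒¬bad (⊴-almostFull _ Symbols Symbols-EmptyFrom) (toTree ∘ c) _ bad
      where
      bad : ∀ {i j} → i < j → ¬ toTree (c i) ⊴ toTree (c j)
      bad {i} {j} i<j cᵢ⊴cⱼ =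
        ≻⇒⋡ (descending (ι ∘ c) step i<j)
            (subst₂ _≽_ (⟦toTree⟧ (c j)) (⟦toTree⟧ (c i)) (⊴⇒≽ cᵢ⊴cⱼ))

    root-≻ : ∀ {l r} (σ : Fin nX → Term ar ⊥) → l ≻ r → ι (l ⟪ σ ⟫) ≻ ι (r ⟪ σ ⟫)
    root-≻ {l} {r} σ l≻r =
      subst₂ _≻_ (sym (⟪⟫-∘ l σ ⊥-elim)) (sym (⟪⟫-∘ r σ ⊥-elim)) (subst-stable (ι ∘ σ) l≻r)

    step-≻ : ∀ {Rs : Rule ar nX → Set} → (∀ {l r} → Rs (l , r) → l ≻ r) →
             ∀ {u u′} → Step ar Rs u u′ → ι u ≻ ι u′
    step-≻ oriented (root ρ σ) = root-≻ σ (oriented ρ)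
    step-≻ oriented (cong f us i {u′} st) =
      subst₂ _≻_ (≡.cong (fun f) ([]≔-lookup ts i)) (≡.cong (fun f) (sym ([]≔-⟪⟫* us ⊥-elim i u′)))
             (F-stable f ts i (subst (_≻ ι u′) (sym (lookup-⟪⟫* us ⊥-elim i)) (step-≻ oriented st)))
      where ts = us ⟪ ⊥-elim ⟫*

  module UsableRules {nX : ℕ} {XA : Set} {R : Rule ar nX → Set} (isR : IsRewriteSystem ar R)
                     (α : Fin nX ⊎ XA → Term ar ⊥) (α-normal : IsGroundSubst ar R α) where

    Usableᴿ : Term ar (Fin nX ⊎ XA) → Rule ar nX → Set
    Usableᴿ = Usable ar R

    rule-top : ∀ {l r f us} (σ : Fin nX → Term ar ⊥) → R (l , r) → l ⟪ σ ⟫ ≡ fun f us → HasTop ar l f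
    rule-top {l} {r} σ ρ lσ≡ with proj₁ (isR l r ρ)
    ... | _ , ls , refl with lσ≡
    ... | refl = ls , refl

    no-step-in-α : ∀ {a u u′} → Step ar R u u′ → u ≢ α (inj₂ a)
    no-step-in-α {a} {u′ = u′} st refl = α-normal a (u′ , st)

    usable-var : ∀ {x r} → _∈V_ ar x r → R ⊆ Usableᴿ (embed ar r)
    usable-var here = uvar _
    usable-var (there {ts = ts} i x∈tsᵢ) =
      uarg i ∘ subst (λ s → Usableᴿ s _) (sym (lookup-⟪⟫* ts _ i)) ∘ usable-var x∈tsᵢ

    usable-[]≔ : ∀ {f ss s′} i → Usableᴿ s′ ⊆ Usableᴿ (lookup ss i) →
                 Usableᴿ (fun f (ss [ i ]≔ s′)) ⊆ Usableᴿ (fun f ss)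
    usable-[]≔ i s′⊆ (utop ρ top) = utop ρ top
    usable-[]≔ i s′⊆ (urhs ρ top p) = urhs ρ top p
    usable-[]≔ {ss = ss} {s′} i s′⊆ (uarg j p) with j Finₚ.≟ i
    ... | yes refl = uarg i (s′⊆ (subst (λ s → Usableᴿ s _) (lookup∘update i ss s′) p))
    ... | no j≢i = uarg j (subst (λ s → Usableᴿ s _) (lookup∘update′ j≢i ss s′) p)

    usable-step : ∀ {s u u′} → Step ar R u u′ → u ≡ s ⟪ α ⟫ → Step ar (Usableᴿ s) u u′
    usable-step {var (inj₂ a)} st u≡ = contradiction u≡ (no-step-in-α st)
    usable-step {var (inj₁ x)} st _ = Step-map (uvar x) st
    usable-step {fun f ss} (root ρ σ) u≡ = root (utop ρ (rule-top σ ρ u≡)) σ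
    usable-step {fun f ss} (cong _ _ i st) refl = cong f _ i (Step-map (uarg i) (usable-step st (lookup-⟪⟫* ss α i)))

    successor : ∀ {s u u′} → Step ar R u u′ → u ≡ s ⟪ α ⟫ →
                R ⊆ Usableᴿ s ⊎ ∃ λ s′ → u′ ≡ s′ ⟪ α ⟫ × Usableᴿ s′ ⊆ Usableᴿ s
    successor {var (inj₂ a)} st u≡ = contradiction u≡ (no-step-in-α st)
    successor {var (inj₁ x)} _ _ = inj₁ (uvar x)
    successor {fun f ss} (root {r = r} ρ σ) u≡ =
      Sum.map (λ (_ , x∈r) → urhs ρ top ∘ usable-var x∈r)
              (λ closed → embed ar r , trans (closed σ (α ∘ inj₁)) (sym (⟪⟫-∘ r _ α)) , urhs ρ top)
              (var-or-closed r)
      where top = rule-top σ ρ u≡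
    successor {fun f ss} (cong _ _ i st) refl with successor st (lookup-⟪⟫* ss α i)
    ... | inj₁ all = inj₁ (uarg i ∘ all)
    ... | inj₂ (s′ , u′≡ , s′⊆) =
      inj₂ (fun f (ss [ i ]≔ s′) ,
            ≡.cong (fun f) (trans (≡.cong (_ [ i ]≔_) u′≡) (sym ([]≔-⟪⟫* ss α i s′))) ,
            usable-[]≔ i s′⊆)

    Invariant : Term ar (Fin nX ⊎ XA) → Term ar ⊥ → Set
    Invariant t u = R ⊆ Usableᴿ t ⊎ ∃ λ s → u ≡ s ⟪ α ⟫ × Usableᴿ s ⊆ Usableᴿ t

    invariant-step : ∀ {t u u′} → Invariant t u → Step ar R u u′ → Step ar (Usableᴿ t) u u′ × Invariant t u′
    invariant-step (inj₁ all) st = Step-map all st , inj₁ all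
    invariant-step (inj₂ (s , u≡ , s⊆t)) st =
      Step-map s⊆t (usable-step st u≡) ,
      Sum.map (λ all ρ → s⊆t (all ρ)) (λ (s′ , u′≡ , s′⊆s) → s′ , u′≡ , s⊆t ∘ s′⊆s)
              (successor st u≡)

proposition6p2p3 : {nF : ℕ} (ar : Fin nF → ℕ) (nX : ℕ) (XA : Set)
    (R : Rule ar nX → Set) → IsRewriteSystem ar R →
    (t : Term ar (Fin nX ⊎ XA)) →
    Σ (Term ar (Fin nX) → Term ar (Fin nX) → Set)
      (λ _≻_ → IsSimplificationOrdering ar _≻_ ×
        ((l r : Term ar (Fin nX)) → Usable ar R t (l , r) → l ≻ r)) →
    (α : Fin nX ⊎ XA → Term ar ⊥) → IsGroundSubst ar R α →
    Terminating ar R (_⟨_⟩ ar t α)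
proposition6p2p3 ar nX XA R isR t (_≻_ , isSO , oriented) α α-normal (c , c₀≡tα , steps) =
  ground-no-descending-chain c λ n → step-≻ (oriented _ _) (proj₁ (usable-steps n))
  where
  open Terms ar
  open Ordered isSO
  open UsableRules isR α α-normal

  invariant : ∀ n → Invariant t (c n)
  usable-steps : ∀ n → Step ar (Usable ar R t) (c n) (c (suc n)) × Invariant t (c (suc n))
  invariant zero = inj₂ (t , c₀≡tα , id)
  invariant (suc n) = proj₂ (usable-steps n)
  usable-steps n = invariant-step (invariant n) (steps n)
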